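{- Let $\mathbf{n}=(n_1,\dots,n_s)\in\mathbb{N}^s$. Then \[ a_\mathbf{n}=(f_\mathbf{n}(\alpha_1),\dots,f_\mathbf{n}(\alpha_s))+\sum_{j=1}^sn_ja_{\mathbf{n}-\mathbf{e}_j}. \] Moreover, if $k,\ell\in\{1,\dots,s\}$ and $n_k\ge1$, then $a_{\mathbf{n}+\mathbf{e}_\ell-\mathbf{e}_k}=a_\mathbf{n}+(\alpha_k-\alpha_\ell)a_{\mathbf{n}-\mathbf{e}_k}$.
   Context: $\mathbb{N}=\{0,1,2,\dots\}$. $K$ is a number field, $\alpha_1,\dots,\alpha_s\in K$ distinct, $\mathbf{e}_1,\dots,\mathbf{e}_s$ the standard basis of $\mathbb{Z}^s$. For $\mathbf{n}\in\mathbb{N}^s$: $f_\mathbf{n}(z)=\prod_i(z-\alpha_i)^{n_i}\in K[z]$, $N=\sum_in_i$, $P_\mathbf{n}(z)=\sum_{k=0}^Nf_\mathbf{n}^{(k)}(z)$ (sum of all derivatives), $a_\mathbf{n}=(P_\mathbf{n}(\alpha_1),\dots,P_\mathbf{n}(\alpha_s))\in K^s$. For $\mathbf{n}\in\mathbb{Z}^s\setminus\mathbb{N}^s$ one sets $f_\mathbf{n}=P_\mathbf{n}=0$ and $a_\mathbf{n}=(0,\dots,0)$. -}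

module Defs where

open import Level using (Level)
open import Algebra.Bundles using (CommutativeRing)
open import Data.Nat as ℕ using (ℕ; zero; suc)
open import Data.Integer as ℤ using (ℤ; +_; ∣_∣)
open import Data.Fin as Fin using (Fin)
open import Data.Fin.Properties using (all?)
open import Data.List using (List; []; _∷_; map)
open import Relation.Nullary using (yes; no; does)
open import Data.Bool using (if_then_else_)

sumℕ : ∀ {s} → (Fin s → ℕ) → ℕ
sumℕ {zero} f = 0
sumℕ {suc s} f = f Fin.zero ℕ.+ sumℕ (λ i → f (Fin.suc i))

e : ∀ {s} → Fin s → Fin s → ℤ
e j i = if does (j Fin.≟ i) then + 1 else + 0

_⊕_ : ∀ {s} → (Fin s → ℤ) → (Fin s → ℤ) → Fin s → ℤ
(u ⊕ v) i = u i ℤ.+ v i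

_⊖_ : ∀ {s} → (Fin s → ℤ) → (Fin s → ℤ) → Fin s → ℤ
(u ⊖ v) i = u i ℤ.- v i

ι : ∀ {s} → (Fin s → ℕ) → Fin s → ℤ
ι n i = + n i

module Poly {c ℓ} (R : CommutativeRing c ℓ) where
  open CommutativeRing R

  _×ℕ_ : ℕ → Carrier → Carrier
  zero ×ℕ x = 0#
  suc n ×ℕ x = x + (n ×ℕ x)

  ΣFin : ∀ {s} → (Fin s → Carrier) → Carrier
  ΣFin {zero} f = 0#
  ΣFin {suc s} f = f Fin.zero + ΣFin (λ i → f (Fin.suc i))

  -- polynomials as coefficient lists, lowest degree first
  Pol : Set c
  Pol = List Carrier

  addP : Pol → Pol → Pol
  addP [] q = q
  addP (a ∷ p) [] = a ∷ p
  addP (a ∷ p) (b ∷ q) = (a + b) ∷ addP p q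

  mulP : Pol → Pol → Pol
  mulP [] q = []
  mulP (a ∷ p) q = addP (map (a *_) q) (0# ∷ mulP p q)

  powP : Pol → ℕ → Pol
  powP p zero = 1# ∷ []
  powP p (suc n) = mulP p (powP p n)

  evalP : Pol → Carrier → Carrier
  evalP [] x = 0#
  evalP (a ∷ p) x = a + x * evalP p x

  derivFrom : ℕ → Pol → Pol
  derivFrom k [] = []
  derivFrom k (a ∷ p) = (k ×ℕ a) ∷ derivFrom (suc k) p

  deriv : Pol → Pol
  deriv [] = []
  deriv (a ∷ p) = derivFrom 1 p

  derivN : ℕ → Pol → Pol
  derivN zero p = p
  derivN (suc k) p = deriv (derivN k p)

  linP : Carrier → Pol
  linP α = (- α) ∷ 1# ∷ []

  prodP : ∀ {s} → (Fin s → Pol) → Pol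
  prodP {zero} g = 1# ∷ []
  prodP {suc s} g = mulP (g Fin.zero) (prodP (λ i → g (Fin.suc i)))

  module Setup {s : ℕ} (α : Fin s → Carrier) where
    f : (Fin s → ℕ) → Pol
    f n = prodP (λ i → powP (linP (α i)) (n i))

    sumDerivs : ℕ → Pol → Pol
    sumDerivs zero p = p
    sumDerivs (suc k) p = addP (sumDerivs k p) (derivN (suc k) p)

    P : (Fin s → ℕ) → Pol
    P n = sumDerivs (sumℕ n) (f n)

    a : (Fin s → ℕ) → Fin s → Carrier
    a n i = evalP (P n) (α i)

    -- extension to ℤ^s: zero outside ℕ^s
    aZ : (Fin s → ℤ) → Fin s → Carrier
    aZ m i with all? (λ j → + 0 ℤ.≤? m j)
    ... | yes _ = a (λ j → ∣ m j ∣) i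
    ... | no _ = 0#

{-# OPTIONS --safe #-}
module Submission where

-- Write D for the formal derivative and N = Σ n_i. Since f_n has degree N, D^(N+1) f_n = 0, so
-- P_n = Σ_{r≤N+1} D^r f_n = f_n + Σ_{r≤N} D^r (D f_n). Leibniz's rule gives
-- D f_n = Σ_j n_j f_{n−e_j}, and for n_j ≥ 1 the polynomial f_{n−e_j} has degree N − 1, so
-- Σ_{r≤N} D^r f_{n−e_j} = P_{n−e_j}; evaluating at α_i gives the first identity. For the second
-- put m = n − e_k: from z − α_l = (z − α_k) + (α_k − α_l) we get
-- f_{m+e_l} = f_{m+e_k} + (α_k − α_l) f_m, and applying the linear map Σ_{r≤N} D^r (which
-- computes P of all three, as their degrees are at most N) and evaluating gives the claim.
-- Neither identity uses that the α_i are distinct.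

open import Defs
open import Algebra.Bundles using (CommutativeRing; CommutativeMonoid)
import Algebra.Properties.CommutativeSemigroup as CommutativeSemigroupProperties
open import Data.Empty using (⊥-elim)
open import Data.Fin as Fin using (Fin)
open import Data.Fin.Properties using (all?)
open import Data.Integer as ℤ using (ℤ; +_)
import Data.Integer.Properties as ℤ
open import Data.List using (List; []; _∷_; map)
open import Data.Nat as ℕ using (ℕ; zero; suc; _≤_; z≤n; s≤s)
import Data.Nat.Properties as ℕ
open import Data.Product using (_×_; _,_)
open import Data.Vec.Functional using (updateAt)
open import Data.Vec.Functional.Properties
  using (updateAt-updates; updateAt-minimal; updateAt-updateAt-local; updateAt-id)
open import Function using (_∘_)
open import Level using (_⊔_)
open import Relation.Binary.Bundles using (Setoid)
import Relation.Binary.Reasoning.Setoid as SetoidReasoning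
open import Relation.Binary.PropositionalEquality as ≡ using (_≡_; _≢_; _≗_)
open import Relation.Nullary using (yes; no)

-- decAt j n is n − e_j only when 1 ≤ n j, since ℕ.pred 0 = 0.

incAt : ∀ {s} → Fin s → (Fin s → ℕ) → Fin s → ℕ
incAt j v = updateAt v j suc

decAt : ∀ {s} → Fin s → (Fin s → ℕ) → Fin s → ℕ
decAt j n = updateAt n j ℕ.pred

incAt-decAt : ∀ {s} {j : Fin s} (n : Fin s → ℕ) → 1 ≤ n j → incAt j (decAt j n) ≗ n
incAt-decAt {j = j} n 1≤nj i = ≡.trans
  (updateAt-updateAt-local j n (ℕ.suc-pred (n j) ⦃ ℕ.>-nonZero 1≤nj ⦄) i)
  (updateAt-id j n i)

sumℕ-cong : ∀ {s} {u v : Fin s → ℕ} → u ≗ v → sumℕ u ≡ sumℕ v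
sumℕ-cong {zero} _ = ≡.refl
sumℕ-cong {suc s} u≗v = ≡.cong₂ ℕ._+_ (u≗v Fin.zero) (sumℕ-cong (u≗v ∘ Fin.suc))

sumℕ-incAt : ∀ {s} (j : Fin s) (v : Fin s → ℕ) → sumℕ (incAt j v) ≡ suc (sumℕ v)
sumℕ-incAt Fin.zero v = ≡.refl
sumℕ-incAt (Fin.suc j) v = ≡.trans
  (≡.cong (v Fin.zero ℕ.+_) (sumℕ-incAt j (v ∘ Fin.suc)))
  (ℕ.+-suc (v Fin.zero) _)

sumℕ-decAt : ∀ {s} {j : Fin s} (n : Fin s → ℕ) → 1 ≤ n j → sumℕ n ≡ suc (sumℕ (decAt j n))
sumℕ-decAt {j = j} n 1≤nj =
  ≡.trans (≡.sym (sumℕ-cong (incAt-decAt n 1≤nj))) (sumℕ-incAt j (decAt j n))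

ι-incAt : ∀ {s} (j : Fin s) (v : Fin s → ℕ) i → ι (incAt j v) i ≡ (ι v ⊕ e j) i
ι-incAt j v i with j Fin.≟ i
... | yes ≡.refl = ≡.cong +_ (≡.trans (updateAt-updates j v) (ℕ.+-comm 1 (v j)))
... | no j≢i =
  ≡.trans (≡.cong +_ (updateAt-minimal i j v (j≢i ∘ ≡.sym))) (≡.sym (ℤ.+-identityʳ (+ v i)))

ι-decAt : ∀ {s} {j : Fin s} (n : Fin s → ℕ) → 1 ≤ n j → ∀ i → (ι n ⊖ e j) i ≡ ι (decAt j n) i
ι-decAt {j = j} n 1≤nj i with j Fin.≟ i
... | yes ≡.refl = begin
  + n j ℤ.- + 1           ≡⟨ ℤ.[+m]-[+n]≡m⊖n (n j) 1 ⟩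
  n j ℤ.⊖ 1               ≡⟨ ℤ.⊖-≥ 1≤nj ⟩
  + ℕ.pred (n j)          ≡⟨ ≡.cong +_ (updateAt-updates j n) ⟨
  + updateAt n j ℕ.pred j ∎
  where open ≡.≡-Reasoning
... | no j≢i =
  ≡.trans (ℤ.+-identityʳ (+ n i)) (≡.cong +_ (≡.sym (updateAt-minimal i j n (j≢i ∘ ≡.sym))))

ι-exchange : ∀ {s} {k : Fin s} (l : Fin s) (n : Fin s → ℕ) → 1 ≤ n k →
             ∀ i → ((ι n ⊕ e l) ⊖ e k) i ≡ ι (incAt l (decAt k n)) i
ι-exchange {k = k} l n 1≤nk i = begin
  (+ n i ℤ.+ e l i) ℤ.- e k i  ≡⟨ ℤ+.xy∙z≈xz∙y (+ n i) (e l i) (ℤ.- e k i) ⟩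
  (+ n i ℤ.- e k i) ℤ.+ e l i  ≡⟨ ≡.cong (ℤ._+ e l i) (ι-decAt n 1≤nk i) ⟩
  ι (decAt k n) i ℤ.+ e l i    ≡⟨ ι-incAt l (decAt k n) i ⟨
  ι (incAt l (decAt k n)) i ∎
  where
  open ≡.≡-Reasoning
  module ℤ+ = CommutativeSemigroupProperties ℤ.+-commutativeSemigroup

module _ {c ℓ} (K : CommutativeRing c ℓ) where
  open CommutativeRing K hiding (zero)
  open Poly K
  module ≈-Reasoning = SetoidReasoning setoid
  module +ᴷ = CommutativeSemigroupProperties +-commutativeSemigroup
  module *ᴷ = CommutativeSemigroupProperties *-commutativeSemigroup

  ×ℕ-congʳ : ∀ m {x y} → x ≈ y → m ×ℕ x ≈ m ×ℕ y
  ×ℕ-congʳ zero x≈y = refl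
  ×ℕ-congʳ (suc m) x≈y = +-cong x≈y (×ℕ-congʳ m x≈y)

  ×ℕ-congʳ-pos : ∀ m {x y} → (1 ≤ m → x ≈ y) → m ×ℕ x ≈ m ×ℕ y
  ×ℕ-congʳ-pos zero _ = refl
  ×ℕ-congʳ-pos (suc m) x≈y = ×ℕ-congʳ (suc m) (x≈y (s≤s z≤n))

  ×ℕ-zeroʳ : ∀ m → m ×ℕ 0# ≈ 0#
  ×ℕ-zeroʳ zero = refl
  ×ℕ-zeroʳ (suc m) = trans (+-identityˡ _) (×ℕ-zeroʳ m)

  ×ℕ-distrib-+ : ∀ m x y → m ×ℕ (x + y) ≈ m ×ℕ x + m ×ℕ y
  ×ℕ-distrib-+ zero x y = sym (+-identityˡ 0#)
  ×ℕ-distrib-+ (suc m) x y = trans (+-congˡ (×ℕ-distrib-+ m x y)) (+ᴷ.interchange x y _ _)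

  ×ℕ-comm-* : ∀ m x y → m ×ℕ (x * y) ≈ x * (m ×ℕ y)
  ×ℕ-comm-* zero x y = sym (zeroʳ x)
  ×ℕ-comm-* (suc m) x y = trans (+-congˡ (×ℕ-comm-* m x y)) (sym (distribˡ x y _))

  ×ℕ-as-* : ∀ m x → (m ×ℕ 1#) * x ≈ m ×ℕ x
  ×ℕ-as-* zero x = zeroˡ x
  ×ℕ-as-* (suc m) x = trans (distribʳ x 1# _) (+-cong (*-identityˡ x) (×ℕ-as-* m x))

  coeff : Pol → ℕ → Carrier
  coeff [] i = 0#
  coeff (a ∷ p) zero = a
  coeff (a ∷ p) (suc i) = coeff p i

  -- A record, so that p and q can be inferred from a proof of p ≋ q.
  infix 4 _≋_
  record _≋_ (p q : Pol) : Set ℓ where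
    constructor coeffwise
    field coeff-≈ : ∀ i → coeff p i ≈ coeff q i
  open _≋_

  ≋-refl : ∀ {p} → p ≋ p
  ≋-refl = coeffwise λ _ → refl

  ≋-sym : ∀ {p q} → p ≋ q → q ≋ p
  ≋-sym p≋q = coeffwise λ i → sym (coeff-≈ p≋q i)

  ≋-trans : ∀ {p q r} → p ≋ q → q ≋ r → p ≋ r
  ≋-trans p≋q q≋r = coeffwise λ i → trans (coeff-≈ p≋q i) (coeff-≈ q≋r i)

  ≋-reflexive : ∀ {p q} → p ≡ q → p ≋ q
  ≋-reflexive ≡.refl = ≋-refl

  ≋-setoid : Setoid c ℓ
  ≋-setoid = record
    { Carrier = Pol ; _≈_ = _≋_
    ; isEquivalence = record { refl = ≋-refl ; sym = ≋-sym ; trans = ≋-trans } }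

  module ≋-Reasoning = SetoidReasoning ≋-setoid

  ∷-cong : ∀ {a b p q} → a ≈ b → p ≋ q → (a ∷ p) ≋ (b ∷ q)
  ∷-cong a≈b p≋q = coeffwise λ { zero → a≈b ; (suc i) → coeff-≈ p≋q i }

  ∷-injectiveʳ : ∀ {a b p q} → (a ∷ p) ≋ (b ∷ q) → p ≋ q
  ∷-injectiveʳ a∷p≋b∷q = coeffwise (coeff-≈ a∷p≋b∷q ∘ suc)

  coeff-addP : ∀ p q i → coeff (addP p q) i ≈ coeff p i + coeff q i
  coeff-addP [] q i = sym (+-identityˡ _)
  coeff-addP (a ∷ p) [] i = sym (+-identityʳ _)
  coeff-addP (a ∷ p) (b ∷ q) zero = refl
  coeff-addP (a ∷ p) (b ∷ q) (suc i) = coeff-addP p q i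

  addP-cong : ∀ {p p′ q q′} → p ≋ p′ → q ≋ q′ → addP p q ≋ addP p′ q′
  addP-cong {p} {p′} {q} {q′} p≋p′ q≋q′ = coeffwise λ i → begin
    coeff (addP p q) i
      ≈⟨ coeff-addP p q i ⟩
    coeff p i + coeff q i
      ≈⟨ +-cong (coeff-≈ p≋p′ i) (coeff-≈ q≋q′ i) ⟩
    coeff p′ i + coeff q′ i
      ≈⟨ coeff-addP p′ q′ i ⟨
    coeff (addP p′ q′) i ∎
    where open ≈-Reasoning

  addP-congˡ : ∀ p {q q′} → q ≋ q′ → addP p q ≋ addP p q′
  addP-congˡ p = addP-cong ≋-refl

  addP-congʳ : ∀ {p p′} q → p ≋ p′ → addP p q ≋ addP p′ q
  addP-congʳ q p≋p′ = addP-cong p≋p′ ≋-refl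

  addP-assoc : ∀ p q r → addP (addP p q) r ≋ addP p (addP q r)
  addP-assoc p q r = coeffwise λ i → begin
    coeff (addP (addP p q) r) i
      ≈⟨ trans (coeff-addP (addP p q) r i) (+-congʳ (coeff-addP p q i)) ⟩
    (coeff p i + coeff q i) + coeff r i
      ≈⟨ +-assoc _ _ _ ⟩
    coeff p i + (coeff q i + coeff r i)
      ≈⟨ trans (coeff-addP p (addP q r) i) (+-congˡ (coeff-addP q r i)) ⟨
    coeff (addP p (addP q r)) i ∎
    where open ≈-Reasoning

  addP-comm : ∀ p q → addP p q ≋ addP q p
  addP-comm p q = coeffwise λ i →
    trans (coeff-addP p q i) (trans (+-comm _ _) (sym (coeff-addP q p i)))

  addP-identityʳ : ∀ p → addP p [] ≋ p
  addP-identityʳ [] = ≋-refl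
  addP-identityʳ (a ∷ p) = ≋-refl

  addP-commutativeMonoid : CommutativeMonoid c ℓ
  addP-commutativeMonoid = record
    { Carrier = Pol ; _≈_ = _≋_ ; _∙_ = addP ; ε = []
    ; isCommutativeMonoid = record
      { isMonoid = record
        { isSemigroup = record
          { isMagma = record { isEquivalence = Setoid.isEquivalence ≋-setoid ; ∙-cong = addP-cong }
          ; assoc = addP-assoc }
        ; identity = (λ _ → ≋-refl) , addP-identityʳ }
      ; comm = addP-comm } }

  module +ᴾ = CommutativeSemigroupProperties (CommutativeMonoid.commutativeSemigroup addP-commutativeMonoid)

  scale : Carrier → Pol → Pol
  scale a = map (a *_)

  coeff-scale : ∀ a p i → coeff (scale a p) i ≈ a * coeff p i
  coeff-scale a [] i = sym (zeroʳ a)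
  coeff-scale a (b ∷ p) zero = refl
  coeff-scale a (b ∷ p) (suc i) = coeff-scale a p i

  scale-cong : ∀ {a b p q} → a ≈ b → p ≋ q → scale a p ≋ scale b q
  scale-cong {a} {b} {p} {q} a≈b p≋q = coeffwise λ i →
    trans (coeff-scale a p i) (trans (*-cong a≈b (coeff-≈ p≋q i)) (sym (coeff-scale b q i)))

  scale-distrib-addP : ∀ a p q → scale a (addP p q) ≋ addP (scale a p) (scale a q)
  scale-distrib-addP a p q = coeffwise λ i → begin
    coeff (scale a (addP p q)) i
      ≈⟨ trans (coeff-scale a (addP p q) i) (*-congˡ (coeff-addP p q i)) ⟩
    a * (coeff p i + coeff q i)
      ≈⟨ distribˡ a _ _ ⟩
    a * coeff p i + a * coeff q i
      ≈⟨ trans (coeff-addP (scale a p) (scale a q) i) (+-cong (coeff-scale a p i) (coeff-scale a q i)) ⟨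
    coeff (addP (scale a p) (scale a q)) i ∎
    where open ≈-Reasoning

  scale-distrib-+ : ∀ a b p → scale (a + b) p ≋ addP (scale a p) (scale b p)
  scale-distrib-+ a b p = coeffwise λ i → begin
    coeff (scale (a + b) p) i
      ≈⟨ coeff-scale (a + b) p i ⟩
    (a + b) * coeff p i
      ≈⟨ distribʳ _ a b ⟩
    a * coeff p i + b * coeff p i
      ≈⟨ trans (coeff-addP (scale a p) (scale b p) i) (+-cong (coeff-scale a p i) (coeff-scale b p i)) ⟨
    coeff (addP (scale a p) (scale b p)) i ∎
    where open ≈-Reasoning

  scale-assoc : ∀ a b p → scale a (scale b p) ≋ scale (a * b) p
  scale-assoc a b p = coeffwise λ i → begin
    coeff (scale a (scale b p)) i
      ≈⟨ trans (coeff-scale a (scale b p) i) (*-congˡ (coeff-scale b p i)) ⟩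
    a * (b * coeff p i)
      ≈⟨ *-assoc a b _ ⟨
    (a * b) * coeff p i
      ≈⟨ coeff-scale (a * b) p i ⟨
    coeff (scale (a * b) p) i ∎
    where open ≈-Reasoning

  scale-identityˡ : ∀ p → scale 1# p ≋ p
  scale-identityˡ p = coeffwise λ i → trans (coeff-scale 1# p i) (*-identityˡ _)

  scale-zeroˡ : ∀ p → scale 0# p ≋ []
  scale-zeroˡ p = coeffwise λ i → trans (coeff-scale 0# p i) (zeroˡ _)

  scale-zeroʳ : ∀ a {p} → p ≋ [] → scale a p ≋ []
  scale-zeroʳ a {p} p≋[] = coeffwise λ i →
    trans (coeff-scale a p i) (trans (*-congˡ (coeff-≈ p≋[] i)) (zeroʳ a))

  evalP-[] : ∀ {p} x → p ≋ [] → evalP p x ≈ 0#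
  evalP-[] {[]} x _ = refl
  evalP-[] {a ∷ p} x a∷p≋[] = begin
    a + x * evalP p x
      ≈⟨ +-cong (coeff-≈ a∷p≋[] zero) (*-congˡ (evalP-[] x p≋[])) ⟩
    0# + x * 0#
      ≈⟨ trans (+-identityˡ _) (zeroʳ x) ⟩
    0# ∎
    where
    open ≈-Reasoning
    p≋[] : p ≋ []
    p≋[] = coeffwise (coeff-≈ a∷p≋[] ∘ suc)

  evalP-cong : ∀ {p q} x → p ≋ q → evalP p x ≈ evalP q x
  evalP-cong {[]} {q} x []≋q = sym (evalP-[] x (≋-sym []≋q))
  evalP-cong {a ∷ p} {[]} x a∷p≋[] = evalP-[] x a∷p≋[]
  evalP-cong {a ∷ p} {b ∷ q} x a∷p≋b∷q =
    +-cong (coeff-≈ a∷p≋b∷q zero) (*-congˡ (evalP-cong x (∷-injectiveʳ a∷p≋b∷q)))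

  evalP-addP : ∀ p q x → evalP (addP p q) x ≈ evalP p x + evalP q x
  evalP-addP [] q x = sym (+-identityˡ _)
  evalP-addP (a ∷ p) [] x = sym (+-identityʳ _)
  evalP-addP (a ∷ p) (b ∷ q) x = begin
    (a + b) + x * evalP (addP p q) x
      ≈⟨ +-congˡ (trans (*-congˡ (evalP-addP p q x)) (distribˡ x _ _)) ⟩
    (a + b) + (x * evalP p x + x * evalP q x)
      ≈⟨ +ᴷ.interchange a b _ _ ⟩
    (a + x * evalP p x) + (b + x * evalP q x) ∎
    where open ≈-Reasoning

  evalP-scale : ∀ a p x → evalP (scale a p) x ≈ a * evalP p x
  evalP-scale a [] x = sym (zeroʳ a)
  evalP-scale a (b ∷ p) x = begin
    a * b + x * evalP (scale a p) x
      ≈⟨ +-congˡ (trans (*-congˡ (evalP-scale a p x)) (*ᴷ.x∙yz≈y∙xz x a _)) ⟩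
    a * b + a * (x * evalP p x)
      ≈⟨ distribˡ a b _ ⟨
    a * (b + x * evalP p x) ∎
    where open ≈-Reasoning

  ΣP : ∀ {s} → (Fin s → Pol) → Pol
  ΣP {zero} g = []
  ΣP {suc s} g = addP (g Fin.zero) (ΣP (g ∘ Fin.suc))

  ΣP-cong : ∀ {s} {g h : Fin s → Pol} → (∀ j → g j ≋ h j) → ΣP g ≋ ΣP h
  ΣP-cong {zero} _ = ≋-refl
  ΣP-cong {suc s} g≋h = addP-cong (g≋h Fin.zero) (ΣP-cong (g≋h ∘ Fin.suc))

  ΣP-[] : ∀ {s} {g : Fin s → Pol} → (∀ j → g j ≋ []) → ΣP g ≋ []
  ΣP-[] {zero} _ = ≋-refl
  ΣP-[] {suc s} g≋[] = addP-cong (g≋[] Fin.zero) (ΣP-[] (g≋[] ∘ Fin.suc))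

  ΣFin-cong : ∀ {s} {g h : Fin s → Carrier} → (∀ j → g j ≈ h j) → ΣFin g ≈ ΣFin h
  ΣFin-cong {zero} _ = refl
  ΣFin-cong {suc s} g≈h = +-cong (g≈h Fin.zero) (ΣFin-cong (g≈h ∘ Fin.suc))

  evalP-ΣP : ∀ {s} (g : Fin s → Pol) x → evalP (ΣP g) x ≈ ΣFin (λ j → evalP (g j) x)
  evalP-ΣP {zero} g x = refl
  evalP-ΣP {suc s} g x = trans (evalP-addP (g Fin.zero) _ x) (+-congˡ (evalP-ΣP (g ∘ Fin.suc) x))

  shift : Pol → Pol
  shift p = 0# ∷ p

  shift-addP : ∀ p q → shift (addP p q) ≋ addP (shift p) (shift q)
  shift-addP p q = ∷-cong (sym (+-identityʳ 0#)) ≋-refl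

  shift-[] : ∀ {p} → p ≋ [] → shift p ≋ []
  shift-[] p≋[] = coeffwise λ { zero → refl ; (suc i) → coeff-≈ p≋[] i }

  mulP-zeroʳ : ∀ p → mulP p [] ≋ []
  mulP-zeroʳ [] = ≋-refl
  mulP-zeroʳ (a ∷ p) = shift-[] (mulP-zeroʳ p)

  mulP-∷ʳ : ∀ p b q → mulP p (b ∷ q) ≋ addP (scale b p) (shift (mulP p q))
  mulP-∷ʳ [] b q = ≋-sym (shift-[] ≋-refl)
  mulP-∷ʳ (a ∷ p) b q = ∷-cong (+-congʳ (*-comm a b)) (begin
    addP (scale a q) (mulP p (b ∷ q))
      ≈⟨ addP-congˡ (scale a q) (mulP-∷ʳ p b q) ⟩
    addP (scale a q) (addP (scale b p) (shift (mulP p q)))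
      ≈⟨ +ᴾ.x∙yz≈y∙xz (scale a q) (scale b p) (shift (mulP p q)) ⟩
    addP (scale b p) (addP (scale a q) (shift (mulP p q))) ∎)
    where open ≋-Reasoning

  mulP-comm : ∀ p q → mulP p q ≋ mulP q p
  mulP-comm [] q = ≋-sym (mulP-zeroʳ q)
  mulP-comm (a ∷ p) q =
    ≋-trans (addP-congˡ (scale a q) (∷-cong refl (mulP-comm p q))) (≋-sym (mulP-∷ʳ q a p))

  mulP-congʳ : ∀ p {q q′} → q ≋ q′ → mulP p q ≋ mulP p q′
  mulP-congʳ [] _ = ≋-refl
  mulP-congʳ (a ∷ p) q≋q′ = addP-cong (scale-cong refl q≋q′) (∷-cong refl (mulP-congʳ p q≋q′))

  mulP-congˡ : ∀ {p p′} q → p ≋ p′ → mulP p q ≋ mulP p′ q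
  mulP-congˡ {p} {p′} q p≋p′ = ≋-trans (mulP-comm p q) (≋-trans (mulP-congʳ q p≋p′) (mulP-comm q p′))

  mulP-distribˡ-addP : ∀ p q r → mulP p (addP q r) ≋ addP (mulP p q) (mulP p r)
  mulP-distribˡ-addP [] q r = ≋-refl
  mulP-distribˡ-addP (a ∷ p) q r = begin
    addP (scale a (addP q r)) (shift (mulP p (addP q r)))
      ≈⟨ addP-cong (scale-distrib-addP a q r)
                   (≋-trans (∷-cong refl (mulP-distribˡ-addP p q r)) (shift-addP (mulP p q) (mulP p r))) ⟩
    addP (addP (scale a q) (scale a r)) (addP (shift (mulP p q)) (shift (mulP p r)))
      ≈⟨ +ᴾ.interchange (scale a q) (scale a r) (shift (mulP p q)) (shift (mulP p r)) ⟩
    addP (addP (scale a q) (shift (mulP p q))) (addP (scale a r) (shift (mulP p r))) ∎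
    where open ≋-Reasoning

  mulP-distribʳ-addP : ∀ p q r → mulP (addP p q) r ≋ addP (mulP p r) (mulP q r)
  mulP-distribʳ-addP p q r = ≋-trans (mulP-comm (addP p q) r)
    (≋-trans (mulP-distribˡ-addP r p q) (addP-cong (mulP-comm r p) (mulP-comm r q)))

  mulP-scaleˡ : ∀ a p q → mulP (scale a p) q ≋ scale a (mulP p q)
  mulP-scaleˡ a [] q = ≋-refl
  mulP-scaleˡ a (b ∷ p) q = begin
    addP (scale (a * b) q) (shift (mulP (scale a p) q))
      ≈⟨ addP-cong (≋-sym (scale-assoc a b q)) (∷-cong (sym (zeroʳ a)) (mulP-scaleˡ a p q)) ⟩
    addP (scale a (scale b q)) (scale a (shift (mulP p q)))
      ≈⟨ scale-distrib-addP a (scale b q) _ ⟨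
    scale a (addP (scale b q) (shift (mulP p q))) ∎
    where open ≋-Reasoning

  mulP-scaleʳ : ∀ a p q → mulP p (scale a q) ≋ scale a (mulP p q)
  mulP-scaleʳ a p q = ≋-trans (mulP-comm p (scale a q))
    (≋-trans (mulP-scaleˡ a q p) (scale-cong refl (mulP-comm q p)))

  mulP-shiftˡ : ∀ p q → mulP (shift p) q ≋ shift (mulP p q)
  mulP-shiftˡ p q = addP-congʳ (shift (mulP p q)) (scale-zeroˡ q)

  mulP-assoc : ∀ p q r → mulP (mulP p q) r ≋ mulP p (mulP q r)
  mulP-assoc [] q r = ≋-refl
  mulP-assoc (a ∷ p) q r = begin
    mulP (addP (scale a q) (shift (mulP p q))) r
      ≈⟨ mulP-distribʳ-addP (scale a q) _ r ⟩
    addP (mulP (scale a q) r) (mulP (shift (mulP p q)) r)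
      ≈⟨ addP-cong (mulP-scaleˡ a q r)
                   (≋-trans (mulP-shiftˡ (mulP p q) r) (∷-cong refl (mulP-assoc p q r))) ⟩
    addP (scale a (mulP q r)) (shift (mulP p (mulP q r))) ∎
    where open ≋-Reasoning

  mulP-comm-left : ∀ p q r → mulP p (mulP q r) ≋ mulP q (mulP p r)
  mulP-comm-left p q r = ≋-trans (≋-sym (mulP-assoc p q r))
    (≋-trans (mulP-congˡ r (mulP-comm p q)) (mulP-assoc q p r))

  mulP-const : ∀ a p → mulP (a ∷ []) p ≋ scale a p
  mulP-const a p = ≋-trans (addP-congˡ (scale a p) (shift-[] ≋-refl)) (addP-identityʳ (scale a p))

  mulP-identityˡ : ∀ p → mulP (1# ∷ []) p ≋ p
  mulP-identityˡ p = ≋-trans (mulP-const 1# p) (scale-identityˡ p)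

  coeff-derivFrom : ∀ k p i → coeff (derivFrom k p) i ≈ (k ℕ.+ i) ×ℕ coeff p i
  coeff-derivFrom k [] i = sym (×ℕ-zeroʳ (k ℕ.+ i))
  coeff-derivFrom k (a ∷ p) zero = reflexive (≡.cong (_×ℕ a) (≡.sym (ℕ.+-identityʳ k)))
  coeff-derivFrom k (a ∷ p) (suc i) = trans (coeff-derivFrom (suc k) p i)
    (reflexive (≡.cong (_×ℕ coeff p i) (≡.sym (ℕ.+-suc k i))))

  coeff-deriv : ∀ p i → coeff (deriv p) i ≈ suc i ×ℕ coeff p (suc i)
  coeff-deriv [] i = sym (×ℕ-zeroʳ (suc i))
  coeff-deriv (a ∷ p) i = coeff-derivFrom 1 p i

  deriv-cong : ∀ {p q} → p ≋ q → deriv p ≋ deriv q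
  deriv-cong {p} {q} p≋q = coeffwise λ i → trans (coeff-deriv p i)
    (trans (×ℕ-congʳ (suc i) (coeff-≈ p≋q (suc i))) (sym (coeff-deriv q i)))

  deriv-addP : ∀ p q → deriv (addP p q) ≋ addP (deriv p) (deriv q)
  deriv-addP p q = coeffwise λ i → begin
    coeff (deriv (addP p q)) i
      ≈⟨ trans (coeff-deriv (addP p q) i) (×ℕ-congʳ (suc i) (coeff-addP p q (suc i))) ⟩
    suc i ×ℕ (coeff p (suc i) + coeff q (suc i))
      ≈⟨ ×ℕ-distrib-+ (suc i) _ _ ⟩
    suc i ×ℕ coeff p (suc i) + suc i ×ℕ coeff q (suc i)
      ≈⟨ trans (coeff-addP (deriv p) (deriv q) i) (+-cong (coeff-deriv p i) (coeff-deriv q i)) ⟨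
    coeff (addP (deriv p) (deriv q)) i ∎
    where open ≈-Reasoning

  deriv-scale : ∀ a p → deriv (scale a p) ≋ scale a (deriv p)
  deriv-scale a p = coeffwise λ i → begin
    coeff (deriv (scale a p)) i
      ≈⟨ trans (coeff-deriv (scale a p) i) (×ℕ-congʳ (suc i) (coeff-scale a p (suc i))) ⟩
    suc i ×ℕ (a * coeff p (suc i))
      ≈⟨ ×ℕ-comm-* (suc i) a _ ⟩
    a * (suc i ×ℕ coeff p (suc i))
      ≈⟨ trans (coeff-scale a (deriv p) i) (*-congˡ (coeff-deriv p i)) ⟨
    coeff (scale a (deriv p)) i ∎
    where open ≈-Reasoning

  deriv-shift : ∀ p → deriv (shift p) ≋ addP p (shift (deriv p))
  deriv-shift p = coeffwise λ
    { zero → trans (coeff-deriv (shift p) zero) (sym (coeff-addP p (shift (deriv p)) zero))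
    ; (suc i) → begin
        coeff (deriv (shift p)) (suc i)              ≈⟨ coeff-deriv (shift p) (suc i) ⟩
        coeff p (suc i) + suc i ×ℕ coeff p (suc i)   ≈⟨ +-congˡ (coeff-deriv p i) ⟨
        coeff p (suc i) + coeff (deriv p) i          ≈⟨ coeff-addP p (shift (deriv p)) (suc i) ⟨
        coeff (addP p (shift (deriv p))) (suc i) ∎ }
    where open ≈-Reasoning

  deriv-mulP : ∀ p q → deriv (mulP p q) ≋ addP (mulP (deriv p) q) (mulP p (deriv q))
  deriv-mulP [] q = ≋-refl
  deriv-mulP (a ∷ p) q = begin
    deriv (addP (scale a q) (shift (mulP p q)))
      ≈⟨ ≋-trans (deriv-addP (scale a q) _) (addP-cong (deriv-scale a q) (deriv-shift (mulP p q))) ⟩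
    addP (scale a q′) (addP (mulP p q) (shift (deriv (mulP p q))))
      ≈⟨ addP-congˡ (scale a q′) (addP-congˡ (mulP p q)
           (≋-trans (∷-cong refl (deriv-mulP p q)) (shift-addP (mulP p′ q) (mulP p q′)))) ⟩
    addP (scale a q′) (addP (mulP p q) (addP (shift (mulP p′ q)) (shift (mulP p q′))))
      ≈⟨ addP-congˡ (scale a q′) (≋-sym (addP-assoc (mulP p q) (shift (mulP p′ q)) (shift (mulP p q′)))) ⟩
    addP (scale a q′) (addP (addP (mulP p q) (shift (mulP p′ q))) (shift (mulP p q′)))
      ≈⟨ +ᴾ.x∙yz≈y∙xz (scale a q′) (addP (mulP p q) (shift (mulP p′ q))) (shift (mulP p q′)) ⟩
    addP (addP (mulP p q) (shift (mulP p′ q))) (addP (scale a q′) (shift (mulP p q′)))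
      ≈⟨ addP-congʳ (mulP (a ∷ p) q′) (addP-congˡ (mulP p q) (mulP-shiftˡ p′ q)) ⟨
    addP (addP (mulP p q) (mulP (shift p′) q)) (mulP (a ∷ p) q′)
      -- deriv (a ∷ p) and deriv (shift p) are both derivFrom 1 p.
      ≈⟨ addP-congʳ (mulP (a ∷ p) q′)
           (≋-trans (mulP-congˡ q (deriv-shift p)) (mulP-distribʳ-addP p (shift p′) q)) ⟨
    addP (mulP (deriv (a ∷ p)) q) (mulP (a ∷ p) q′) ∎
    where
    open ≋-Reasoning
    p′ = deriv p
    q′ = deriv q

  derivN-suc : ∀ k p → derivN (suc k) p ≡ derivN k (deriv p)
  derivN-suc zero p = ≡.refl
  derivN-suc (suc k) p = ≡.cong deriv (derivN-suc k p)

  record IsLinear (L : Pol → Pol) : Set (c ⊔ ℓ) where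
    field
      ≋-cong : ∀ {p q} → p ≋ q → L p ≋ L q
      addP-homo : ∀ p q → L (addP p q) ≋ addP (L p) (L q)
      scale-homo : ∀ a p → L (scale a p) ≋ scale a (L p)
  open IsLinear

  id-isLinear : IsLinear (λ p → p)
  id-isLinear = record
    { ≋-cong = λ p≋q → p≋q ; addP-homo = λ _ _ → ≋-refl ; scale-homo = λ _ _ → ≋-refl }

  deriv-isLinear : IsLinear deriv
  deriv-isLinear = record { ≋-cong = deriv-cong ; addP-homo = deriv-addP ; scale-homo = deriv-scale }

  mulP-isLinear : ∀ p → IsLinear (mulP p)
  mulP-isLinear p = record
    { ≋-cong = mulP-congʳ p ; addP-homo = mulP-distribˡ-addP p ; scale-homo = λ a q → mulP-scaleʳ a p q }

  ∘-isLinear : ∀ {L M} → IsLinear L → IsLinear M → IsLinear (L ∘ M)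
  ∘-isLinear {L} {M} L-lin M-lin = record
    { ≋-cong = ≋-cong L-lin ∘ ≋-cong M-lin
    ; addP-homo = λ p q → ≋-trans (≋-cong L-lin (addP-homo M-lin p q)) (addP-homo L-lin (M p) (M q))
    ; scale-homo = λ a p → ≋-trans (≋-cong L-lin (scale-homo M-lin a p)) (scale-homo L-lin a (M p)) }

  addP-isLinear : ∀ {L M} → IsLinear L → IsLinear M → IsLinear (λ p → addP (L p) (M p))
  addP-isLinear {L} {M} L-lin M-lin = record
    { ≋-cong = λ p≋q → addP-cong (≋-cong L-lin p≋q) (≋-cong M-lin p≋q)
    ; addP-homo = λ p q → ≋-trans (addP-cong (addP-homo L-lin p q) (addP-homo M-lin p q))
                                  (+ᴾ.interchange (L p) (L q) (M p) (M q))
    ; scale-homo = λ a p → ≋-trans (addP-cong (scale-homo L-lin a p) (scale-homo M-lin a p))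
                                   (≋-sym (scale-distrib-addP a (L p) (M p))) }

  linear-[] : ∀ {L} → IsLinear L → L [] ≋ []
  linear-[] {L} L-lin = ≋-trans (scale-homo L-lin 0# []) (scale-zeroˡ (L []))

  linear-ΣP : ∀ {L} → IsLinear L → ∀ {s} (g : Fin s → Pol) → L (ΣP g) ≋ ΣP (L ∘ g)
  linear-ΣP L-lin {zero} g = linear-[] L-lin
  linear-ΣP {L} L-lin {suc s} g = ≋-trans (addP-homo L-lin (g Fin.zero) (ΣP (g ∘ Fin.suc)))
    (addP-congˡ (L (g Fin.zero)) (linear-ΣP L-lin (g ∘ Fin.suc)))

  derivN-isLinear : ∀ k → IsLinear (derivN k)
  derivN-isLinear zero = id-isLinear
  derivN-isLinear (suc k) = ∘-isLinear deriv-isLinear (derivN-isLinear k)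

  deriv-linP : ∀ β → deriv (linP β) ≋ (1# ∷ [])
  deriv-linP β = ∷-cong (+-identityʳ 1#) ≋-refl

  scale-×ℕ-powP-pred : ∀ q m →
                       scale (m ×ℕ 1#) (mulP q (powP q (ℕ.pred m))) ≋ scale (m ×ℕ 1#) (powP q m)
  scale-×ℕ-powP-pred q zero = ≋-trans (scale-zeroˡ _) (≋-sym (scale-zeroˡ _))
  scale-×ℕ-powP-pred q (suc m) = ≋-refl

  deriv-powP-linP : ∀ β m → deriv (powP (linP β) m) ≋ scale (m ×ℕ 1#) (powP (linP β) (ℕ.pred m))
  deriv-powP-linP β zero = ≋-sym (scale-zeroˡ (1# ∷ []))
  deriv-powP-linP β (suc m) = begin
    deriv (mulP L (powP L m))
      ≈⟨ deriv-mulP L (powP L m) ⟩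
    addP (mulP (deriv L) (powP L m)) (mulP L (deriv (powP L m)))
      ≈⟨ addP-cong (≋-trans (mulP-congˡ (powP L m) (deriv-linP β)) (mulP-identityˡ (powP L m)))
                   (≋-trans (mulP-congʳ L (deriv-powP-linP β m)) (mulP-scaleʳ (m ×ℕ 1#) L _)) ⟩
    addP (powP L m) (scale (m ×ℕ 1#) (mulP L (powP L (ℕ.pred m))))
      ≈⟨ addP-cong (≋-sym (scale-identityˡ (powP L m))) (scale-×ℕ-powP-pred L m) ⟩
    addP (scale 1# (powP L m)) (scale (m ×ℕ 1#) (powP L m))
      ≈⟨ scale-distrib-+ 1# (m ×ℕ 1#) (powP L m) ⟨
    scale (suc m ×ℕ 1#) (powP L m) ∎
    where
    open ≋-Reasoning
    L = linP β

  prodP-cong : ∀ {s} {g h : Fin s → Pol} → (∀ i → g i ≋ h i) → prodP g ≋ prodP h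
  prodP-cong {zero} _ = ≋-refl
  prodP-cong {suc s} {g} {h} g≋h =
    ≋-trans (mulP-congˡ (prodP (g ∘ Fin.suc)) (g≋h Fin.zero))
            (mulP-congʳ (h Fin.zero) (prodP-cong (g≋h ∘ Fin.suc)))

  f-cong : ∀ {s} (β : Fin s → Carrier) {n n′ : Fin s → ℕ} → n ≗ n′ → Setup.f β n ≋ Setup.f β n′
  f-cong β n≗n′ = prodP-cong λ i → ≋-reflexive (≡.cong (powP (linP (β i))) (n≗n′ i))

  f-incAt : ∀ {s} (β : Fin s → Carrier) (j : Fin s) v →
            Setup.f β (incAt j v) ≋ mulP (linP (β j)) (Setup.f β v)
  f-incAt β Fin.zero v =
    mulP-assoc (linP (β Fin.zero)) (powP (linP (β Fin.zero)) (v Fin.zero)) (Setup.f (β ∘ Fin.suc) (v ∘ Fin.suc))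
  f-incAt β (Fin.suc j) v = ≋-trans
    (mulP-congʳ P₀ (f-incAt (β ∘ Fin.suc) j (v ∘ Fin.suc)))
    (mulP-comm-left P₀ (linP (β (Fin.suc j))) (Setup.f (β ∘ Fin.suc) (v ∘ Fin.suc)))
    where P₀ = powP (linP (β Fin.zero)) (v Fin.zero)

  deriv-f : ∀ {s} (β : Fin s → Carrier) (n : Fin s → ℕ) →
            deriv (Setup.f β n) ≋ ΣP (λ j → scale (n j ×ℕ 1#) (Setup.f β (decAt j n)))
  deriv-f {zero} β n = ≋-refl
  deriv-f {suc s} β n = begin
    deriv (mulP P₀ F)
      ≈⟨ deriv-mulP P₀ F ⟩
    addP (mulP (deriv P₀) F) (mulP P₀ (deriv F))
      ≈⟨ addP-cong (mulP-congˡ F (deriv-powP-linP (β Fin.zero) (n Fin.zero)))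
                   (mulP-congʳ P₀ (deriv-f β′ n′)) ⟩
    addP (mulP (scale c₀ Q₀) F) (mulP P₀ (ΣP G))
      ≈⟨ addP-cong (mulP-scaleˡ c₀ Q₀ F) (linear-ΣP (mulP-isLinear P₀) G) ⟩
    addP (scale c₀ (mulP Q₀ F)) (ΣP (mulP P₀ ∘ G))
      ≈⟨ addP-congˡ (scale c₀ (mulP Q₀ F))
           (ΣP-cong λ j → mulP-scaleʳ (n′ j ×ℕ 1#) P₀ (Setup.f β′ (decAt j n′))) ⟩
    ΣP (λ j → scale (n j ×ℕ 1#) (Setup.f β (decAt j n))) ∎
    where
    open ≋-Reasoning
    β′ = β ∘ Fin.suc
    n′ = n ∘ Fin.suc
    P₀ = powP (linP (β Fin.zero)) (n Fin.zero)
    Q₀ = powP (linP (β Fin.zero)) (ℕ.pred (n Fin.zero))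
    F = Setup.f β′ n′
    c₀ = n Fin.zero ×ℕ 1#
    G : Fin s → Pol
    G j = scale (n′ j ×ℕ 1#) (Setup.f β′ (decAt j n′))

  scale-×ℕ-[] : ∀ m {p} → (1 ≤ m → p ≋ []) → scale (m ×ℕ 1#) p ≋ []
  scale-×ℕ-[] zero {p} _ = scale-zeroˡ p
  scale-×ℕ-[] (suc m) p≋[] = scale-zeroʳ (suc m ×ℕ 1#) (p≋[] (s≤s z≤n))

  derivN-f-vanish : ∀ {s} (β : Fin s → Carrier) N (n : Fin s → ℕ) →
                    sumℕ n ≡ N → derivN (suc N) (Setup.f β n) ≋ []
  derivN-f-vanish {s} β N n Σn≡N = begin
    derivN (suc N) (f n)    ≡⟨ derivN-suc N (f n) ⟩
    derivN N (deriv (f n))  ≈⟨ ≋-cong (derivN-isLinear N) (deriv-f β n) ⟩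
    derivN N (ΣP G)         ≈⟨ linear-ΣP (derivN-isLinear N) G ⟩
    ΣP (derivN N ∘ G)       ≈⟨ ΣP-[] term ⟩
    [] ∎
    where
    open ≋-Reasoning
    f = Setup.f β
    G : Fin s → Pol
    G j = scale (n j ×ℕ 1#) (f (decAt j n))
    term : ∀ j → derivN N (G j) ≋ []
    term j = ≋-trans (scale-homo (derivN-isLinear N) (n j ×ℕ 1#) (f (decAt j n)))
      (scale-×ℕ-[] (n j) λ 1≤nj → vanish (≡.trans (≡.sym (sumℕ-decAt n 1≤nj)) Σn≡N))
      where
      vanish : ∀ {M} → suc (sumℕ (decAt j n)) ≡ M → derivN M (f (decAt j n)) ≋ []
      vanish {suc M} eq = derivN-f-vanish β M (decAt j n) (ℕ.suc-injective eq)

  module _ {s : ℕ} (α : Fin s → Carrier) where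
    open Setup α

    sumDerivs-isLinear : ∀ k → IsLinear (sumDerivs k)
    sumDerivs-isLinear zero = id-isLinear
    sumDerivs-isLinear (suc k) = addP-isLinear (sumDerivs-isLinear k) (derivN-isLinear (suc k))

    sumDerivs-suc : ∀ k p → sumDerivs (suc k) p ≋ addP p (sumDerivs k (deriv p))
    sumDerivs-suc zero p = ≋-refl
    sumDerivs-suc (suc k) p = begin
      addP (sumDerivs (suc k) p) (derivN (suc (suc k)) p)
        ≈⟨ addP-cong (sumDerivs-suc k p) (≋-reflexive (derivN-suc (suc k) p)) ⟩
      addP (addP p (sumDerivs k (deriv p))) (derivN (suc k) (deriv p))
        ≈⟨ addP-assoc p (sumDerivs k (deriv p)) (derivN (suc k) (deriv p)) ⟩
      addP p (sumDerivs (suc k) (deriv p)) ∎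
      where open ≋-Reasoning

    P-stable : ∀ v → sumDerivs (suc (sumℕ v)) (f v) ≋ P v
    P-stable v = ≋-trans (addP-congˡ (P v) (derivN-f-vanish α (sumℕ v) v ≡.refl)) (addP-identityʳ (P v))

    a-cong : ∀ {n n′} → n ≗ n′ → ∀ i → a n i ≈ a n′ i
    a-cong {n} {n′} n≗n′ i = trans
      (evalP-cong (α i) (≋-cong (sumDerivs-isLinear (sumℕ n)) (f-cong α n≗n′)))
      (reflexive (≡.cong (λ N → evalP (sumDerivs N (f n′)) (α i)) (sumℕ-cong n≗n′)))

    aZ-ι : ∀ {u : Fin s → ℤ} {v} → (∀ j → u j ≡ ι v j) → ∀ i → aZ u i ≈ a v i
    aZ-ι {u} {v} u≗ιv i with all? (λ j → + 0 ℤ.≤? u j)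
    ... | yes _ = a-cong (λ j → ≡.cong ℤ.∣_∣ (u≗ιv j)) i
    ... | no u≱0 = ⊥-elim (u≱0 λ j → ≡.subst (+ 0 ℤ.≤_) (≡.sym (u≗ιv j)) (ℤ.+≤+ z≤n))

    a-decAt : ∀ {j} n → 1 ≤ n j → ∀ i →
              evalP (sumDerivs (sumℕ n) (f (decAt j n))) (α i) ≈ aZ (ι n ⊖ e j) i
    a-decAt {j} n 1≤nj i = begin
      evalP (sumDerivs (sumℕ n) (f v)) (α i)
        ≡⟨ ≡.cong (λ N → evalP (sumDerivs N (f v)) (α i)) (sumℕ-decAt n 1≤nj) ⟩
      evalP (sumDerivs (suc (sumℕ v)) (f v)) (α i)
        ≈⟨ evalP-cong (α i) (P-stable v) ⟩
      a v i
        ≈⟨ aZ-ι (ι-decAt n 1≤nj) i ⟨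
      aZ (ι n ⊖ e j) i ∎
      where
      open ≈-Reasoning
      v = decAt j n

    a-recurrence : ∀ n i → a n i ≈ evalP (f n) (α i) + ΣFin (λ j → n j ×ℕ aZ (ι n ⊖ e j) i)
    a-recurrence n i = begin
      a n i
        ≈⟨ evalP-cong x (P-stable n) ⟨
      evalP (sumDerivs (suc N) (f n)) x
        ≈⟨ evalP-cong x (sumDerivs-suc N (f n)) ⟩
      evalP (addP (f n) (sumDerivs N (deriv (f n)))) x
        ≈⟨ evalP-addP (f n) _ x ⟩
      evalP (f n) x + evalP (sumDerivs N (deriv (f n))) x
        ≈⟨ +-congˡ (evalP-cong x (≋-cong (sumDerivs-isLinear N) (deriv-f α n))) ⟩
      evalP (f n) x + evalP (sumDerivs N (ΣP G)) x
        ≈⟨ +-congˡ (evalP-cong x (linear-ΣP (sumDerivs-isLinear N) G)) ⟩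
      evalP (f n) x + evalP (ΣP (sumDerivs N ∘ G)) x
        ≈⟨ +-congˡ (evalP-ΣP (sumDerivs N ∘ G) x) ⟩
      evalP (f n) x + ΣFin (λ j → evalP (sumDerivs N (G j)) x)
        ≈⟨ +-congˡ (ΣFin-cong term) ⟩
      evalP (f n) x + ΣFin (λ j → n j ×ℕ aZ (ι n ⊖ e j) i) ∎
      where
      open ≈-Reasoning
      x = α i
      N = sumℕ n
      G : Fin s → Pol
      G j = scale (n j ×ℕ 1#) (f (decAt j n))
      term : ∀ j → evalP (sumDerivs N (G j)) x ≈ n j ×ℕ aZ (ι n ⊖ e j) i
      term j = begin
        evalP (sumDerivs N (G j)) x
          ≈⟨ evalP-cong x (scale-homo (sumDerivs-isLinear N) (n j ×ℕ 1#) (f (decAt j n))) ⟩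
        evalP (scale (n j ×ℕ 1#) (sumDerivs N (f (decAt j n)))) x
          ≈⟨ evalP-scale (n j ×ℕ 1#) (sumDerivs N (f (decAt j n))) x ⟩
        (n j ×ℕ 1#) * evalP (sumDerivs N (f (decAt j n))) x
          ≈⟨ ×ℕ-as-* (n j) _ ⟩
        n j ×ℕ evalP (sumDerivs N (f (decAt j n))) x
          ≈⟨ ×ℕ-congʳ-pos (n j) (λ 1≤nj → a-decAt n 1≤nj i) ⟩
        n j ×ℕ aZ (ι n ⊖ e j) i ∎

    linP-split : ∀ y z → linP z ≋ addP (linP y) ((y - z) ∷ [])
    linP-split y z = ∷-cong (begin
      - z
        ≈⟨ +-identityˡ (- z) ⟨
      0# + - z
        ≈⟨ +-congʳ (-‿inverseˡ y) ⟨
      (- y + y) + - z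
        ≈⟨ +-assoc (- y) y (- z) ⟩
      - y + (y - z) ∎) ≋-refl
      where open ≈-Reasoning

    f-incAt-exchange : ∀ k l v → f (incAt l v) ≋ addP (f (incAt k v)) (scale (α k - α l) (f v))
    f-incAt-exchange k l v = begin
      f (incAt l v)
        ≈⟨ f-incAt α l v ⟩
      mulP (linP (α l)) (f v)
        ≈⟨ mulP-congˡ (f v) (linP-split (α k) (α l)) ⟩
      mulP (addP (linP (α k)) ((α k - α l) ∷ [])) (f v)
        ≈⟨ mulP-distribʳ-addP (linP (α k)) ((α k - α l) ∷ []) (f v) ⟩
      addP (mulP (linP (α k)) (f v)) (mulP ((α k - α l) ∷ []) (f v))
        ≈⟨ addP-cong (≋-sym (f-incAt α k v)) (mulP-const (α k - α l) (f v)) ⟩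
      addP (f (incAt k v)) (scale (α k - α l) (f v)) ∎
      where open ≋-Reasoning

    a-incAt-exchange : ∀ k l v i → a (incAt l v) i ≈ a (incAt k v) i + (α k - α l) * a v i
    a-incAt-exchange k l v i = begin
      a (incAt l v) i
        ≡⟨ ≡.cong (λ N → evalP (sumDerivs N (f (incAt l v))) x) (sumℕ-incAt l v) ⟩
      evalP (S (f (incAt l v))) x
        ≈⟨ evalP-cong x (≋-cong (sumDerivs-isLinear (suc V)) (f-incAt-exchange k l v)) ⟩
      evalP (S (addP (f (incAt k v)) (scale γ (f v)))) x
        ≈⟨ evalP-cong x (addP-homo (sumDerivs-isLinear (suc V)) (f (incAt k v)) (scale γ (f v))) ⟩
      evalP (addP (S (f (incAt k v))) (S (scale γ (f v)))) x
        ≈⟨ evalP-addP (S (f (incAt k v))) (S (scale γ (f v))) x ⟩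
      evalP (S (f (incAt k v))) x + evalP (S (scale γ (f v))) x
        ≈⟨ +-congˡ (trans (evalP-cong x (scale-homo (sumDerivs-isLinear (suc V)) γ (f v)))
                          (evalP-scale γ (S (f v)) x)) ⟩
      evalP (S (f (incAt k v))) x + γ * evalP (S (f v)) x
        ≈⟨ +-congˡ (*-congˡ (evalP-cong x (P-stable v))) ⟩
      evalP (S (f (incAt k v))) x + γ * a v i
        ≡⟨ ≡.cong (λ N → evalP (sumDerivs N (f (incAt k v))) x + γ * a v i) (sumℕ-incAt k v) ⟨
      a (incAt k v) i + γ * a v i ∎
      where
      open ≈-Reasoning
      x = α i
      γ = α k - α l
      V = sumℕ v
      S = sumDerivs (suc V)

    aZ-exchange : ∀ n k l → 1 ≤ n k → ∀ i →
                  aZ ((ι n ⊕ e l) ⊖ e k) i ≈ a n i + (α k - α l) * aZ (ι n ⊖ e k) i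
    aZ-exchange n k l 1≤nk i = begin
      aZ ((ι n ⊕ e l) ⊖ e k) i
        ≈⟨ aZ-ι (ι-exchange l n 1≤nk) i ⟩
      a (incAt l v) i
        ≈⟨ a-incAt-exchange k l v i ⟩
      a (incAt k v) i + (α k - α l) * a v i
        ≈⟨ +-cong (a-cong (incAt-decAt n 1≤nk) i) (*-congˡ (sym (aZ-ι (ι-decAt n 1≤nk) i))) ⟩
      a n i + (α k - α l) * aZ (ι n ⊖ e k) i ∎
      where
      open ≈-Reasoning
      v = decAt k n

propositionA1 : ∀ {c ℓ} (K : CommutativeRing c ℓ) (s : ℕ)
    (α : Fin s → CommutativeRing.Carrier K) →
    (∀ i j → CommutativeRing._≈_ K (α i) (α j) → i ≡ j) →
    (n : Fin s → ℕ) →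
    let open CommutativeRing K
        open Poly K
        open Setup α
    in (∀ i → a n i ≈ (evalP (f n) (α i) + ΣFin (λ j → n j ×ℕ aZ (ι n ⊖ e j) i)))
       × (∀ k l → 1 ≤ n k → ∀ i →
            aZ ((ι n ⊕ e l) ⊖ e k) i ≈ (a n i + (α k - α l) * aZ (ι n ⊖ e k) i))
propositionA1 K s α _ n = a-recurrence K α n , λ k l → aZ-exchange K α n k l
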